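{- For every integer $n\ge 0$, \[ \binom{2n}{n}\sum_{k=0}^{n}\binom{n}{k}^2\binom{2k}{k}\binom{2n-2k}{n-k}=\sum_{k=0}^{n}\binom{2n}{2k}\binom{2k}{k}^2\binom{2n-2k}{n-k}^2. \]
   Context: $\binom{m}{j}$ is the usual binomial coefficient. -}

module Defs where

open import Data.Nat using (ℕ; zero; suc; _+_)

sumTo : ℕ → (ℕ → ℕ) → ℕ
sumTo zero    f = f 0
sumTo (suc n) f = sumTo n f + f (suc n)

-- Both sides are sums over the same k, and they agree term by term: writing m = n − k,
-- each of C(2n,n)·C(n,k)² and C(2n,2k)·C(2k,k)·C(2m,m) is the multinomial coefficient
-- (2n)! / (k!² m!²), counted by splitting 2n into the blocks k,k,m,m in two different orders.
module Submission where

open import Defs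
open import Data.Nat using (ℕ; zero; suc; _+_; _*_; _∸_; _≤_; z≤n; NonZero; _!)
open import Data.Nat.Combinatorics using (_C_; nCk≡n!/k![n-k]!; k![n∸k]!∣n!)
open import Data.Nat.DivMod using (m/n*n≡m)
open import Data.Nat.Properties
open import Data.Product using (_,_)
open import Relation.Binary.PropositionalEquality
open import Algebra.Properties.CommutativeSemigroup +-commutativeSemigroup
  using () renaming (interchange to +-interchange)
open import Algebra.Properties.CommutativeSemigroup *-commutativeSemigroup
  using () renaming (interchange to *-interchange)
open import Data.Nat.Solver using (module +-*-Solver)
open +-*-Solver using (solve; _:*_; _:=_)

sumTo-distribˡ : ∀ c m f → c * sumTo m f ≡ sumTo m (λ k → c * f k)
sumTo-distribˡ c zero    f = refl
sumTo-distribˡ c (suc m) f = trans (*-distribˡ-+ c (sumTo m f) (f (suc m)))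
  (cong (_+ c * f (suc m)) (sumTo-distribˡ c m f))

sumTo-cong : ∀ m {f g} → (∀ {k} → k ≤ m → f k ≡ g k) → sumTo m f ≡ sumTo m g
sumTo-cong zero    f≗g = f≗g z≤n
sumTo-cong (suc m) f≗g = cong₂ _+_ (sumTo-cong m (λ k≤m → f≗g (m≤n⇒m≤1+n k≤m))) (f≗g ≤-refl)

[m+n]Cm*[m!*n!]≡[m+n]! : ∀ m n → ((m + n) C m) * (m ! * n !) ≡ (m + n) !
[m+n]Cm*[m!*n!]≡[m+n]! m n = subst (λ o → ((m + n) C m) * (m ! * o !) ≡ (m + n) !) (m+n∸m≡n m n)
  (trans (cong (_* (m ! * (m + n ∸ m) !)) (nCk≡n!/k![n-k]! (m≤m+n m n)))
         (m/n*n≡m {{m !* (m + n ∸ m) !≢0}} (k![n∸k]!∣n! (m≤m+n m n))))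

choose-blocks : ℕ → ℕ → ℕ → ℕ → ℕ
choose-blocks a b c d = (((a + b) + (c + d)) C (a + b)) * ((a + b) C a) * ((c + d) C c)

block-factorials : ℕ → ℕ → ℕ → ℕ → ℕ
block-factorials a b c d = (a ! * b !) * (c ! * d !)

choose-blocks*block-factorials≡! : ∀ a b c d →
  choose-blocks a b c d * block-factorials a b c d ≡ ((a + b) + (c + d)) !
choose-blocks*block-factorials≡! a b c d = begin
  x * y * z * ((a ! * b !) * (c ! * d !))
    ≡⟨ solve 7 (λ x y z a b c d → x :* y :* z :* ((a :* b) :* (c :* d))
                                := x :* ((y :* (a :* b)) :* (z :* (c :* d)))) refl x y z (a !) (b !) (c !) (d !) ⟩
  x * ((y * (a ! * b !)) * (z * (c ! * d !)))
    ≡⟨ cong₂ (λ u v → x * (u * v)) ([m+n]Cm*[m!*n!]≡[m+n]! a b) ([m+n]Cm*[m!*n!]≡[m+n]! c d) ⟩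
  x * ((a + b) ! * (c + d) !)
    ≡⟨ [m+n]Cm*[m!*n!]≡[m+n]! (a + b) (c + d) ⟩
  ((a + b) + (c + d)) ! ∎
  where
  open ≡-Reasoning
  x = ((a + b) + (c + d)) C (a + b)
  y = (a + b) C a
  z = (c + d) C c

choose-blocks-interchange : ∀ a b c d → choose-blocks a b c d ≡ choose-blocks a c b d
choose-blocks-interchange a b c d = *-cancelʳ-≡ _ _ (block-factorials a b c d) {{nonZero}} (begin
  choose-blocks a b c d * block-factorials a b c d  ≡⟨ choose-blocks*block-factorials≡! a b c d ⟩
  ((a + b) + (c + d)) !                              ≡⟨ cong _! (+-interchange a b c d) ⟩
  ((a + c) + (b + d)) !                              ≡⟨ choose-blocks*block-factorials≡! a c b d ⟨
  choose-blocks a c b d * block-factorials a c b d  ≡⟨ cong (choose-blocks a c b d *_) (*-interchange (a !) (c !) (b !) (d !)) ⟩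
  choose-blocks a c b d * block-factorials a b c d  ∎)
  where
  open ≡-Reasoning
  nonZero : NonZero (block-factorials a b c d)
  nonZero = m*n≢0 _ _ {{m*n≢0 _ _ {{a !≢0}} {{b !≢0}}}} {{m*n≢0 _ _ {{c !≢0}} {{d !≢0}}}}

2*n≡n+n : ∀ n → 2 * n ≡ n + n
2*n≡n+n n = cong (n +_) (+-identityʳ n)

[2n]C[2k]*[2k]Ck*[2n∸2k]C[n∸k]≡[2n]Cn*[nCk]² : ∀ {n k} → k ≤ n →
  ((2 * n) C (2 * k)) * ((2 * k) C k) * ((2 * n ∸ 2 * k) C (n ∸ k)) ≡ ((2 * n) C n) * ((n C k) * (n C k))
[2n]C[2k]*[2k]Ck*[2n∸2k]C[n∸k]≡[2n]Cn*[nCk]² {k = k} k≤n with m , refl ← m≤n⇒∃[o]m+o≡n k≤n = begin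
  ((2 * (k + m)) C (2 * k)) * ((2 * k) C k) * ((2 * (k + m) ∸ 2 * k) C ((k + m) ∸ k))
    ≡⟨ cong₂ (λ D M → ((2 * (k + m)) C (2 * k)) * ((2 * k) C k) * (D C M)) 2[k+m]∸2k≡m+m (m+n∸m≡n k m) ⟩
  ((2 * (k + m)) C (2 * k)) * ((2 * k) C k) * ((m + m) C m)
    ≡⟨ cong₂ (λ N K → (N C K) * (K C k) * ((m + m) C m)) 2[k+m]≡[k+k]+[m+m] (2*n≡n+n k) ⟩
  (((k + k) + (m + m)) C (k + k)) * ((k + k) C k) * ((m + m) C m)
    ≡⟨ choose-blocks-interchange k k m m ⟩
  (((k + m) + (k + m)) C (k + m)) * ((k + m) C k) * ((k + m) C k)
    ≡⟨ cong (λ N → (N C (k + m)) * ((k + m) C k) * ((k + m) C k)) (2*n≡n+n (k + m)) ⟨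
  ((2 * (k + m)) C (k + m)) * ((k + m) C k) * ((k + m) C k)
    ≡⟨ *-assoc ((2 * (k + m)) C (k + m)) ((k + m) C k) ((k + m) C k) ⟩
  ((2 * (k + m)) C (k + m)) * (((k + m) C k) * ((k + m) C k)) ∎
  where
  open ≡-Reasoning
  2[k+m]≡[k+k]+[m+m] : 2 * (k + m) ≡ (k + k) + (m + m)
  2[k+m]≡[k+k]+[m+m] = trans (2*n≡n+n (k + m)) (+-interchange k m k m)
  2[k+m]∸2k≡m+m : 2 * (k + m) ∸ 2 * k ≡ m + m
  2[k+m]∸2k≡m+m = trans (cong (_∸ 2 * k) (*-distribˡ-+ 2 k m)) (trans (m+n∸m≡n (2 * k) (2 * m)) (2*n≡n+n m))

mainTheorem10 : (n : ℕ) →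
    ((2 * n) C n) * sumTo n (λ k → (n C k) * (n C k) * ((2 * k) C k) * ((2 * n ∸ 2 * k) C (n ∸ k)))
      ≡ sumTo n (λ k → ((2 * n) C (2 * k)) * (((2 * k) C k) * ((2 * k) C k)) * (((2 * n ∸ 2 * k) C (n ∸ k)) * ((2 * n ∸ 2 * k) C (n ∸ k))))
mainTheorem10 n = trans (sumTo-distribˡ ((2 * n) C n) n _) (sumTo-cong n termwise)
  where
  termwise : ∀ {k} → k ≤ n →
    ((2 * n) C n) * ((n C k) * (n C k) * ((2 * k) C k) * ((2 * n ∸ 2 * k) C (n ∸ k)))
      ≡ ((2 * n) C (2 * k)) * (((2 * k) C k) * ((2 * k) C k)) * (((2 * n ∸ 2 * k) C (n ∸ k)) * ((2 * n ∸ 2 * k) C (n ∸ k)))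
  termwise {k} k≤n = begin
    c * (x * x * y * z)      ≡⟨ solve 4 (λ c x y z → c :* (x :* x :* y :* z) := c :* (x :* x) :* y :* z) refl c x y z ⟩
    c * (x * x) * y * z      ≡⟨ cong (λ u → u * y * z) ([2n]C[2k]*[2k]Ck*[2n∸2k]C[n∸k]≡[2n]Cn*[nCk]² k≤n) ⟨
    w * y * z * y * z        ≡⟨ solve 3 (λ w y z → w :* y :* z :* y :* z := w :* (y :* y) :* (z :* z)) refl w y z ⟩
    w * (y * y) * (z * z)    ∎
    where
    open ≡-Reasoning
    c = (2 * n) C n
    x = n C k
    y = (2 * k) C k
    z = (2 * n ∸ 2 * k) C (n ∸ k)
    w = (2 * n) C (2 * k)
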